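{- Let $\vec S\subseteq\vec U$ be a structurally submodular separation system inside a universe $\vec U$, and let $P$ be a profile of $S$. Then there exists a star $\sigma\subseteq P$ such that no other profile of $S$ includes $\sigma$.
   Context: A separation system is a finite poset $(\vec S,\le)$ with an order-reversing involution ${}^*$; write $\overleftarrow s:=\vec s^{\,*}$, $s:=\{\vec s,\overleftarrow s\}$, and $S$ for the set of such unoriented separations. A star is a set $\sigma\subseteq\vec S$ with $\vec s\le\overleftarrow t$ for all distinct $\vec s,\vec t\in\sigma$. A universe is a separation system $\vec U$ whose poset is a lattice with join $\vee$ and meet $\wedge$. $\vec S\subseteq\vec U$ is structurally submodular if for all $\vec s,\vec t\in\vec S$ at least one of $\vec s\vee\vec t$, $\vec s\wedge\vec t$ lies in $\vec S$. An orientation of $S$ is a set $O\subseteq\vec S$ containing exactly one of $\vec s,\overleftarrow s$ for each $s\in S$; it is consistent if it contains no $\vec r,\vec s$ with $r\neq s$ and $\overleftarrow r\le\vec s$. A profile of $S$ is a consistent orientation $P$ of $S$ with $\overleftarrow r\wedge\overleftarrow s\notin P$ for all $\vec r,\vec s\in P$. A profile includes $\sigma$ if $\sigma\subseteq P$. -}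

module Defs where

open import Data.Nat using (ℕ)
open import Data.Fin using (Fin)
open import Data.Fin.Subset using (Subset; _∈_; _∉_; _⊆_)
open import Data.Product using (_×_)
open import Data.Sum using (_⊎_)
open import Relation.Nullary using (¬_; Dec)
open import Relation.Binary.Core using (Rel)
open import Relation.Binary.Definitions using (Decidable)
open import Relation.Binary.Structures using (IsPartialOrder)
open import Relation.Binary.Lattice.Definitions using (Supremum; Infimum)
open import Relation.Binary.PropositionalEquality using (_≡_; _≢_)

-- A universe of separations on the finite carrier Fin n:
-- a finite lattice (join _∨_, meet _∧_) with an order-reversing involution _*.
-- (Decidability of ≤ is classically automatic for a finite poset.)
record Universe (n : ℕ) : Set₁ where
  infix 4 _≤_
  infixr 6 _∨_
  infixr 7 _∧_
  field
    _≤_            : Rel (Fin n) _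
    isPartialOrder : IsPartialOrder _≡_ _≤_
    _≤?_           : Decidable _≤_
    _*             : Fin n → Fin n
    *-involutive   : ∀ x → (x *) * ≡ x
    *-reversing    : ∀ {x y} → x ≤ y → y * ≤ x *
    _∨_            : Fin n → Fin n → Fin n
    _∧_            : Fin n → Fin n → Fin n
    supremum       : Supremum _≤_ _∨_
    infimum        : Infimum _≤_ _∧_

module _ {n : ℕ} (U : Universe n) where
  open Universe U

  IsSeparationSystem : Subset n → Set
  IsSeparationSystem S = ∀ {s} → s ∈ S → s * ∈ S

  StructurallySubmodular : Subset n → Set
  StructurallySubmodular S =
    ∀ {s t} → s ∈ S → t ∈ S → (s ∨ t) ∈ S ⊎ (s ∧ t) ∈ S

  IsStar : Subset n → Set
  IsStar σ = ∀ {s t} → s ∈ σ → t ∈ σ → s ≢ t → s ≤ t *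

  IsOrientation : Subset n → Subset n → Set
  IsOrientation S O =
    O ⊆ S ×
    (∀ {s} → s ∈ S → s ∈ O ⊎ s * ∈ O) ×
    (∀ {s} → s ∈ O → s * ∈ O → s ≡ s *)

  DistinctUnoriented : Fin n → Fin n → Set
  DistinctUnoriented r s = r ≢ s × r * ≢ s

  IsConsistent : Subset n → Set
  IsConsistent O =
    ∀ {r s} → r ∈ O → s ∈ O → DistinctUnoriented r s → ¬ (r * ≤ s)

  IsProfile : Subset n → Subset n → Set
  IsProfile S P =
    IsOrientation S P × IsConsistent P ×
    (∀ {r s} → r ∈ P → s ∈ P → ((r *) ∧ (s *)) ∉ P)

-- Among the subsets σ ⊆ P that force P (every profile containing σ contains P, hence equals
-- P), consider one minimising Σ_{x ∈ σ} |↓ x|, starting from σ = P. If σ is not a star, pick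
-- r, s ∈ σ with r ≰ s*; up to exchanging r and s, structural submodularity puts r ∨ s* in S.
-- If r ∨ s* ∈ P, consistency forces r < s and r can be dropped from σ. Otherwise
-- (r ∨ s*)* = r* ∧ s < s lies in P and may replace s, since a profile containing r and
-- r* ∧ s cannot contain s*. Either move lowers the weight.
module Submission where

open import Defs
open import Data.Nat using (ℕ; _+_)
open import Data.Fin.Subset using (Subset; _⊆_)
open import Data.Product using (_×_; Σ-syntax)
open import Relation.Binary.PropositionalEquality using (_≡_)

open import Data.Fin using (Fin; zero; suc; _≟_)
open import Data.Fin.Properties using (any?)
open import Data.Fin.Subset using (_∈_; _∉_; _⊂_; _-_; _∪_; ⁅_⁆; ∣_∣; inside; outside)
open import Data.Fin.Subset.Properties
  using (_∈?_; ⊆-antisym; ∪-identityˡ; p─⊥≡p; p─q⊆p; x∈p∪q⁻; x∈p∪q⁺; x∈⁅x⁆; x∈⁅y⁆⇒x≡y;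
         x∈p∧x≢y⇒x∈p-y; ∣⁅x⁆∣≡1; p⊆q⇒∣p∣≤∣q∣; p⊂q⇒∣p∣<∣q∣)
import Data.Nat as ℕ
open import Data.Nat.Induction using (<-wellFounded)
import Data.Nat.Properties as ℕₚ
open import Algebra.Properties.CommutativeSemigroup ℕₚ.+-commutativeSemigroup using (x∙yz≈y∙xz)
open import Data.Product using (_,_; proj₁; proj₂)
open import Data.Sum using (_⊎_; inj₁; inj₂)
open import Data.Vec using ([]; _∷_; here; there; tabulate)
open import Data.Vec.Properties using ([]=⇒lookup; lookup⇒[]=; lookup∘tabulate)
open import Function using (_∘_)
open import Induction.WellFounded using (Acc; acc)
open import Relation.Binary.Lattice using (Lattice)
open import Relation.Binary.PropositionalEquality
  using (_≢_; refl; sym; trans; cong; cong₂; subst; ≢-sym; module ≡-Reasoning)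
open import Relation.Nullary using (¬_; yes; no; does; contradiction)
open import Relation.Nullary.Decidable using (¬?; _×-dec_; dec-true; decidable-stable)
open import Relation.Unary using (Pred; Decidable)

∈-tabulate-does⁺ : ∀ {n ℓ} {P : Pred (Fin n) ℓ} (P? : Decidable P) {x} → P x → x ∈ tabulate (does ∘ P?)
∈-tabulate-does⁺ P? {x} px = lookup⇒[]= x _ (trans (lookup∘tabulate (does ∘ P?) x) (dec-true (P? x) px))

∈-tabulate-does⁻ : ∀ {n ℓ} {P : Pred (Fin n) ℓ} (P? : Decidable P) {x} → x ∈ tabulate (does ∘ P?) → P x
∈-tabulate-does⁻ P? {x} x∈ with P? x | trans (sym (lookup∘tabulate (does ∘ P?) x)) ([]=⇒lookup x∈)
... | yes px | _  = px
... | no _   | ()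

p-x⊆q⇒p⊆q : ∀ {n} {p q : Subset n} {x} → x ∈ q → p - x ⊆ q → p ⊆ q
p-x⊆q⇒p⊆q {x = x} x∈q p-x⊆q {y} y∈p with y ≟ x
... | yes refl = x∈q
... | no y≢x   = p-x⊆q (x∈p∧x≢y⇒x∈p-y y∈p y≢x)

weight : ∀ {n} → (Fin n → ℕ) → Subset n → ℕ
weight w []            = 0
weight w (inside  ∷ p) = w zero + weight (w ∘ suc) p
weight w (outside ∷ p) = weight (w ∘ suc) p

weight-∷ : ∀ {n} (w : Fin (ℕ.suc n) → ℕ) s p → weight (w ∘ suc) p ℕ.≤ weight w (s ∷ p)
weight-∷ w inside  p = ℕₚ.m≤n+m _ (w zero)
weight-∷ w outside p = ℕₚ.≤-refl

weight-remove : ∀ {n} (w : Fin n → ℕ) {x} p → x ∈ p → weight w p ≡ w x + weight w (p - x)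
weight-remove w (inside ∷ p) here = cong (λ q → w zero + weight (w ∘ suc) q) (sym (p─⊥≡p p))
weight-remove w (inside ∷ p) (there x∈p) =
  trans (cong (w zero +_) (weight-remove (w ∘ suc) p x∈p)) (x∙yz≈y∙xz (w zero) (w (suc _)) _)
weight-remove w (outside ∷ p) (there x∈p) = weight-remove (w ∘ suc) p x∈p

weight-⁅⁆∪ : ∀ {n} (w : Fin n → ℕ) x p → weight w (⁅ x ⁆ ∪ p) ℕ.≤ w x + weight w p
weight-⁅⁆∪ w zero    (s ∷ p) rewrite ∪-identityˡ p = ℕₚ.+-monoʳ-≤ (w zero) (weight-∷ w s p)
weight-⁅⁆∪ w (suc x) (inside ∷ p) =
  ℕₚ.≤-trans (ℕₚ.+-monoʳ-≤ (w zero) (weight-⁅⁆∪ (w ∘ suc) x p))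
             (ℕₚ.≤-reflexive (x∙yz≈y∙xz (w zero) (w (suc x)) _))
weight-⁅⁆∪ w (suc x) (outside ∷ p) = weight-⁅⁆∪ (w ∘ suc) x p

module _ {n : ℕ} (U : Universe n) where
  open Universe U

  private
    lattice : Lattice _ _ _
    lattice = record
      { isLattice = record { isPartialOrder = isPartialOrder ; supremum = supremum ; infimum = infimum } }

  open Lattice lattice
    using (antisym; x≤x∨y; y≤x∨y; ∨-least; x∧y≤x; x∧y≤y; ∧-greatest; joinSemilattice)
    renaming (refl to ≤-refl; trans to ≤-trans)
  open import Relation.Binary.Lattice.Properties.JoinSemilattice joinSemilattice using (∨-comm)

  ≤-*-swap : ∀ {x y} → x ≤ y * → y ≤ x *
  ≤-*-swap {x} {y} x≤y* = subst (_≤ x *) (*-involutive y) (*-reversing x≤y*)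

  *-≤-swap : ∀ {x y} → x * ≤ y → y * ≤ x
  *-≤-swap {x} {y} x*≤y = subst (y * ≤_) (*-involutive x) (*-reversing x*≤y)

  *-∨ : ∀ x y → (x ∨ y) * ≡ x * ∧ y *
  *-∨ x y = antisym
    (∧-greatest (*-reversing (x≤x∨y x y)) (*-reversing (y≤x∨y x y)))
    (≤-*-swap (∨-least (≤-*-swap (x∧y≤x (x *) (y *))) (≤-*-swap (x∧y≤y (x *) (y *)))))

  *-∧ : ∀ x y → (x ∧ y) * ≡ x * ∨ y *
  *-∧ x y = begin
    (x ∧ y) *             ≡⟨ cong _* (cong₂ _∧_ (sym (*-involutive x)) (sym (*-involutive y))) ⟩
    (x * * ∧ y * *) *     ≡⟨ cong _* (sym (*-∨ (x *) (y *))) ⟩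
    (x * ∨ y *) * *       ≡⟨ *-involutive (x * ∨ y *) ⟩
    x * ∨ y *             ∎
    where open ≡-Reasoning

  ↓_ : Fin n → Subset n
  ↓ x = tabulate (does ∘ (_≤? x))

  ↓-⊂ : ∀ {x y} → y ≤ x → y ≢ x → ↓ y ⊂ ↓ x
  ↓-⊂ {x} {y} y≤x y≢x =
    (λ z∈↓y → ∈-tabulate-does⁺ (_≤? x) (≤-trans (∈-tabulate-does⁻ (_≤? y) z∈↓y) y≤x)) ,
    x , ∈-tabulate-does⁺ (_≤? x) ≤-refl , λ x∈↓y → y≢x (antisym y≤x (∈-tabulate-does⁻ (_≤? y) x∈↓y))

  size : Subset n → ℕ
  size = weight (∣_∣ ∘ ↓_)

  ↓-nonempty : ∀ x → 0 ℕ.< ∣ ↓ x ∣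
  ↓-nonempty x = subst (ℕ._≤ ∣ ↓ x ∣) (∣⁅x⁆∣≡1 x) (p⊆q⇒∣p∣≤∣q∣ ⁅x⁆⊆↓x)
    where
    ⁅x⁆⊆↓x : ⁅ x ⁆ ⊆ ↓ x
    ⁅x⁆⊆↓x y∈⁅x⁆ = subst (_∈ ↓ x) (sym (x∈⁅y⁆⇒x≡y x y∈⁅x⁆)) (∈-tabulate-does⁺ (_≤? x) ≤-refl)

  size-remove : ∀ {σ a} → a ∈ σ → size (σ - a) ℕ.< size σ
  size-remove {σ} {a} a∈σ = begin-strict
    size (σ - a)            <⟨ ℕₚ.m<n+m (size (σ - a)) (↓-nonempty a) ⟩
    ∣ ↓ a ∣ + size (σ - a)  ≡⟨ weight-remove (∣_∣ ∘ ↓_) σ a∈σ ⟨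
    size σ                  ∎
    where open ℕₚ.≤-Reasoning

  size-replace : ∀ {σ a b} → a ∈ σ → b ≤ a → b ≢ a → size (⁅ b ⁆ ∪ (σ - a)) ℕ.< size σ
  size-replace {σ} {a} {b} a∈σ b≤a b≢a = begin-strict
    size (⁅ b ⁆ ∪ (σ - a))  ≤⟨ weight-⁅⁆∪ (∣_∣ ∘ ↓_) b (σ - a) ⟩
    ∣ ↓ b ∣ + size (σ - a)  <⟨ ℕₚ.+-monoˡ-< (size (σ - a)) (p⊂q⇒∣p∣<∣q∣ (↓-⊂ b≤a b≢a)) ⟩
    ∣ ↓ a ∣ + size (σ - a)  ≡⟨ weight-remove (∣_∣ ∘ ↓_) σ a∈σ ⟨
    size σ                  ∎
    where open ℕₚ.≤-Reasoning

  NonStarPair : Subset n → Set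
  NonStarPair σ = Σ[ r ∈ Fin n ] Σ[ s ∈ Fin n ] r ∈ σ × s ∈ σ × r ≢ s × ¬ (r ≤ s *)

  star⊎nonStarPair : ∀ σ → IsStar U σ ⊎ NonStarPair σ
  star⊎nonStarPair σ
    with any? (λ r → any? (λ s → r ∈? σ ×-dec s ∈? σ ×-dec ¬? (r ≟ s) ×-dec ¬? (r ≤? (s *))))
  ... | yes pair = inj₂ pair
  ... | no none  = inj₁ λ {r} {s} r∈σ s∈σ r≢s →
    decidable-stable (r ≤? (s *)) λ r≰s* → none (r , s , r∈σ , s∈σ , r≢s , r≰s*)

  module Profile {S Q : Subset n} (Q-profile : IsProfile U S Q) where
    ⊆S : Q ⊆ S
    ⊆S = proj₁ (proj₁ Q-profile)

    oriented : ∀ {x} → x ∈ S → x ∈ Q ⊎ x * ∈ Q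
    oriented = proj₁ (proj₂ (proj₁ Q-profile))

    degenerate : ∀ {x} → x ∈ Q → x * ∈ Q → x ≡ x *
    degenerate = proj₂ (proj₂ (proj₁ Q-profile))

    consistent : IsConsistent U Q
    consistent = proj₁ (proj₂ Q-profile)

    ∧*∉ : ∀ {r s} → r ∈ Q → s ∈ Q → r * ∧ s * ∉ Q
    ∧*∉ = proj₂ (proj₂ Q-profile)

  orientation-⊆⇒≡ : ∀ {S P Q} → IsOrientation U S P → IsOrientation U S Q → P ⊆ Q → Q ≡ P
  orientation-⊆⇒≡ {P = P} (_ , P-oriented , _) (Q⊆S , _ , Q-degenerate) P⊆Q = ⊆-antisym Q⊆P P⊆Q
    where
    Q⊆P : _ ⊆ P
    Q⊆P {x} x∈Q with P-oriented (Q⊆S x∈Q)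
    ... | inj₁ x∈P  = x∈P
    ... | inj₂ x*∈P = subst (_∈ P) (sym (Q-degenerate x∈Q (P⊆Q x*∈P))) x*∈P

  consistent⇒downward-closed : ∀ {S Q a b} → IsOrientation U S Q → IsConsistent U Q →
    a ∈ S → a ≤ b → a ≢ b → a * ≢ b → b ∈ Q → a ∈ Q
  consistent⇒downward-closed {a = a} (_ , Q-oriented , _) Q-consistent a∈S a≤b a≢b a*≢b b∈Q
    with Q-oriented a∈S
  ... | inj₁ a∈Q  = a∈Q
  ... | inj₂ a*∈Q = contradiction (subst (_≤ _) (sym (*-involutive a)) a≤b)
                      (Q-consistent a*∈Q b∈Q (a*≢b , a≢b ∘ trans (sym (*-involutive a))))

  module _ {S : Subset n} (S-sep : IsSeparationSystem U S) (S-submod : StructurallySubmodular U S)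
           {P : Subset n} (P-profile : IsProfile U S P) where
    open Profile P-profile using () renaming
      (⊆S to P⊆S; oriented to P-oriented; degenerate to P-degenerate; consistent to P-consistent)

    Forces : Subset n → Set
    Forces σ = σ ⊆ P × (∀ Q → IsProfile U S Q → σ ⊆ Q → P ⊆ Q)

    forces-from : ∀ {σ τ} → Forces σ → τ ⊆ P → (∀ Q → IsProfile U S Q → τ ⊆ Q → σ ⊆ Q) → Forces τ
    forces-from (_ , σ-forces) τ⊆P τ⇒σ =
      τ⊆P , λ Q Q-profile τ⊆Q → σ-forces Q Q-profile (τ⇒σ Q Q-profile τ⊆Q)

    P-forces-itself : Forces P
    P-forces-itself = (λ x∈P → x∈P) , λ _ _ P⊆Q → P⊆Q

    Improvement : Subset n → Set
    Improvement σ = Σ[ τ ∈ Subset n ] Forces τ × size τ ℕ.< size σ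

    improve-by-removal : ∀ {σ a b} → Forces σ → a ∈ σ → b ∈ σ → a ≤ b → a ≢ b → Improvement σ
    improve-by-removal {σ} {a} {b} σ-forces@(σ⊆P , _) a∈σ b∈σ a≤b a≢b =
      σ - a , forces-from σ-forces (σ⊆P ∘ p─q⊆p σ ⁅ a ⁆) σ⊆Q , size-remove a∈σ
      where
      a*≢b : a * ≢ b
      a*≢b a*≡b = a≢b (trans (P-degenerate (σ⊆P a∈σ) (subst (_∈ P) (sym a*≡b) (σ⊆P b∈σ))) a*≡b)

      σ⊆Q : ∀ Q → IsProfile U S Q → σ - a ⊆ Q → σ ⊆ Q
      σ⊆Q Q Q-profile σ-a⊆Q = p-x⊆q⇒p⊆q a∈Q σ-a⊆Q
        where
        a∈Q : a ∈ Q
        a∈Q = consistent⇒downward-closed (proj₁ Q-profile) (Profile.consistent Q-profile)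
                (P⊆S (σ⊆P a∈σ)) a≤b a≢b a*≢b (σ-a⊆Q (x∈p∧x≢y⇒x∈p-y b∈σ (≢-sym a≢b)))

    improve-by-replacement : ∀ {σ a b} → Forces σ → a ∈ σ → b ∈ P → b ≤ a → b ≢ a →
      (∀ Q → IsProfile U S Q → ⁅ b ⁆ ∪ (σ - a) ⊆ Q → a ∈ Q) → Improvement σ
    improve-by-replacement {σ} {a} {b} σ-forces@(σ⊆P , _) a∈σ b∈P b≤a b≢a a-kept =
      ⁅ b ⁆ ∪ (σ - a) , forces-from σ-forces τ⊆P σ⊆Q , size-replace a∈σ b≤a b≢a
      where
      τ⊆P : ⁅ b ⁆ ∪ (σ - a) ⊆ P
      τ⊆P {x} x∈τ with x∈p∪q⁻ ⁅ b ⁆ (σ - a) x∈τ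
      ... | inj₁ x∈⁅b⁆ = subst (_∈ P) (sym (x∈⁅y⁆⇒x≡y b x∈⁅b⁆)) b∈P
      ... | inj₂ x∈σ-a = σ⊆P (p─q⊆p σ ⁅ a ⁆ x∈σ-a)

      σ⊆Q : ∀ Q → IsProfile U S Q → ⁅ b ⁆ ∪ (σ - a) ⊆ Q → σ ⊆ Q
      σ⊆Q Q Q-profile τ⊆Q = p-x⊆q⇒p⊆q (a-kept Q Q-profile τ⊆Q) (τ⊆Q ∘ x∈p∪q⁺ ∘ inj₂)

    improve-at-join : ∀ {σ r s} → Forces σ → r ∈ σ → s ∈ σ → r ≢ s → ¬ (r ≤ s *) →
      r ∨ s * ∈ S → Improvement σ
    improve-at-join {σ} {r} {s} σ-forces@(σ⊆P , _) r∈σ s∈σ r≢s r≰s* z∈S with P-oriented z∈S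
    ... | inj₁ z∈P =
      improve-by-removal σ-forces r∈σ s∈σ (subst (r ≤_) (sym s≡z) (x≤x∨y r (s *))) r≢s
      where
      s*≢z : s * ≢ r ∨ s *
      s*≢z s*≡z = r≰s* (subst (r ≤_) (sym s*≡z) (x≤x∨y r (s *)))

      s≡z : s ≡ r ∨ s *
      s≡z = decidable-stable (s ≟ r ∨ s *) λ s≢z →
        P-consistent (σ⊆P s∈σ) z∈P (s≢z , s*≢z) (y≤x∨y r (s *))
    ... | inj₂ z*∈P =
      improve-by-replacement σ-forces s∈σ z*∈P (*-≤-swap (y≤x∨y r (s *))) z*≢s s-kept
      where
      z*≢s : (r ∨ s *) * ≢ s
      z*≢s z*≡s = r≰s* (subst (r ≤_) (trans (sym (*-involutive _)) (cong _* z*≡s)) (x≤x∨y r (s *)))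

      s-kept : ∀ Q → IsProfile U S Q → ⁅ (r ∨ s *) * ⁆ ∪ (σ - s) ⊆ Q → s ∈ Q
      s-kept Q Q-profile τ⊆Q with Profile.oriented Q-profile (P⊆S (σ⊆P s∈σ))
      ... | inj₁ s∈Q  = s∈Q
      ... | inj₂ s*∈Q =
        contradiction (subst (_∈ Q) (*-∨ r (s *)) z*∈Q) (Profile.∧*∉ Q-profile r∈Q s*∈Q)
        where
        z*∈Q : (r ∨ s *) * ∈ Q
        z*∈Q = τ⊆Q (x∈p∪q⁺ (inj₁ (x∈⁅x⁆ _)))

        r∈Q : r ∈ Q
        r∈Q = τ⊆Q (x∈p∪q⁺ (inj₂ (x∈p∧x≢y⇒x∈p-y r∈σ r≢s)))

    improve : ∀ {σ} → Forces σ → NonStarPair σ → Improvement σ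
    improve σ-forces@(σ⊆P , _) (r , s , r∈σ , s∈σ , r≢s , r≰s*)
      with S-submod (P⊆S (σ⊆P r∈σ)) (S-sep (P⊆S (σ⊆P s∈σ)))
    ... | inj₁ r∨s*∈S = improve-at-join σ-forces r∈σ s∈σ r≢s r≰s* r∨s*∈S
    ... | inj₂ r∧s*∈S = improve-at-join σ-forces s∈σ r∈σ (≢-sym r≢s) (r≰s* ∘ ≤-*-swap) s∨r*∈S
      where
      s∨r*∈S : s ∨ r * ∈ S
      s∨r*∈S = subst (_∈ S) (begin
        (r ∧ s *) *  ≡⟨ *-∧ r (s *) ⟩
        r * ∨ s * *  ≡⟨ cong (r * ∨_) (*-involutive s) ⟩
        r * ∨ s      ≡⟨ ∨-comm (r *) s ⟩
        s ∨ r *      ∎) (S-sep r∧s*∈S)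
        where open ≡-Reasoning

    forcing-star : ∀ σ → Forces σ → Acc ℕ._<_ (size σ) → Σ[ τ ∈ Subset n ] IsStar U τ × Forces τ
    forcing-star σ σ-forces (acc smaller) with star⊎nonStarPair σ
    ... | inj₁ σ-star = σ , σ-star , σ-forces
    ... | inj₂ pair with improve σ-forces pair
    ...   | τ , τ-forces , τ<σ = forcing-star τ τ-forces (smaller τ<σ)

mainTheorem2 : {n : ℕ} (U : Universe n) (S : Subset n) →
    IsSeparationSystem U S → StructurallySubmodular U S →
    (P : Subset n) → IsProfile U S P →
    Σ[ σ ∈ Subset n ] (IsStar U σ × σ ⊆ P ×
    ((Q : Subset n) → IsProfile U S Q → σ ⊆ Q → Q ≡ P))
mainTheorem2 U S S-sep S-submod P P-profile
  with forcing-star U S-sep S-submod P-profile P (P-forces-itself U S-sep S-submod P-profile)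
         (<-wellFounded _)
... | σ , σ-star , σ⊆P , σ-forces =
  σ , σ-star , σ⊆P , λ Q Q-profile σ⊆Q →
    orientation-⊆⇒≡ U (proj₁ P-profile) (proj₁ Q-profile) (σ-forces Q Q-profile σ⊆Q)
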